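{- Let $(G,k,F,w)$ be an instance of \textsc{Generalized 2-Club Cluster Vertex Deletion} with $G=(V,E)$. Let $v\in V\setminus F$ be a cut vertex of $G$ that is not a bridge vertex, and let $C$ be (the vertex set of) a connected component of $G-v$ such that $G[C]$ is a 2-club and $w(v)\le\min_{u\in C}w(u)$. Then $(G,k,F,w)$ is a yes-instance if and only if $(G,k,F\cup C,w)$ is a yes-instance.
   Context: All graphs are finite, simple and undirected. A 2-club is a graph of diameter at most two; a 2-club cluster graph is a graph each of whose connected components is a 2-club. A cut vertex is a vertex whose deletion increases the number of connected components. An induced $P_4$ $stuv$ is a path on distinct vertices $s,t,u,v$ with edges $\{s,t\},\{t,u\},\{u,v\}$ and no other edges among these four vertices. A vertex $b$ is a bridge vertex if there are $s,v\in N(b)$ and vertices $t,u$ such that $stuv$ is an induced $P_4$ in $G$. For a weight function $w$ and a vertex set $S$, $w(S)=\sum_{x\in S}w(x)$. \textsc{Generalized 2-Club Cluster Vertex Deletion}: an instance $(G,k,F,w)$ consists of an undirected graph $G=(V,E)$, an integer $k$, a set $F\subseteq V$ of permanent vertices and a weight function $w:V\to\mathbb{N}^+$; it is a yes-instance iff there is $S\subseteq V$ with $w(S)\le k$ and $S\cap F=\emptyset$ such that $G[V\setminus S]$ is a 2-club cluster graph. -}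

module Defs where

open import Data.Nat using (ℕ; zero; suc; _+_; _≤_)
open import Data.Integer using (ℤ; +_) renaming (_≤_ to _≤ℤ_)
open import Data.Bool using (Bool; true; false; if_then_else_)
open import Data.Fin using (Fin; zero; suc)
open import Data.Fin.Subset using (Subset; _∈_; _∉_; _⊆_; ∁; ⁅_⁆; _∪_; Empty)
open import Data.Vec using ([]; _∷_)
open import Data.Product using (Σ; ∃; _×_; _,_)
open import Data.Sum using (_⊎_)
open import Relation.Binary.PropositionalEquality using (_≡_; _≢_)
open import Relation.Nullary using (¬_)
open import Function using (_∘_)

record Graph (n : ℕ) : Set where
  field
    adj     : Fin n → Fin n → Bool
    symm    : ∀ x y → adj x y ≡ adj y x
    irrefl  : ∀ x → adj x x ≡ false

module _ {n : ℕ} (G : Graph n) where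
  open Graph G

  Adj : Fin n → Fin n → Set
  Adj x y = adj x y ≡ true

  data Reach (S : Subset n) : Fin n → Fin n → Set where
    here : ∀ {x} → x ∈ S → Reach S x x
    step : ∀ {x y z} → x ∈ S → Adj x y → Reach S y z → Reach S x z

  Dist≤2 : Subset n → Fin n → Fin n → Set
  Dist≤2 S x y = x ≡ y ⊎ Adj x y ⊎ (∃ λ z → z ∈ S × Adj x z × Adj z y)

  Is2Club : Subset n → Set
  Is2Club S = ∀ x y → x ∈ S → y ∈ S → Dist≤2 S x y

  -- G[S] is a 2-club cluster graph: every connected component is a 2-club,
  -- i.e. any two vertices in the same component of G[S] have distance ≤ 2 in G[S]
  Is2ClubCluster : Subset n → Set
  Is2ClubCluster S = ∀ x y → Reach S x y → Dist≤2 S x y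

  IsComponent : Subset n → Subset n → Set
  IsComponent S C =
    (∃ λ x → x ∈ C) × C ⊆ S ×
    (∀ x y → x ∈ C → y ∈ S → (y ∈ C → Reach S x y) × (Reach S x y → y ∈ C))

  all-but : Fin n → Subset n
  all-but v = ∁ ⁅ v ⁆

  -- v is a cut vertex: deleting v disconnects two vertices that were connected,
  -- i.e. increases the number of connected components
  IsCutVertex : Fin n → Set
  IsCutVertex v = ∃ λ x → ∃ λ y → x ≢ v × y ≢ v ×
    Reach (∁ Data.Fin.Subset.⊥) x y × ¬ Reach (all-but v) x y

  InducedP4 : Fin n → Fin n → Fin n → Fin n → Set
  InducedP4 s t u v =
    s ≢ t × s ≢ u × s ≢ v × t ≢ u × t ≢ v × u ≢ v ×
    Adj s t × Adj t u × Adj u v ×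
    ¬ Adj s u × ¬ Adj s v × ¬ Adj t v

  IsBridgeVertex : Fin n → Set
  IsBridgeVertex b = ∃ λ s → ∃ λ v → Adj b s × Adj b v ×
    ∃ λ t → ∃ λ u → InducedP4 s t u v

wsum : {n : ℕ} → (Fin n → ℕ) → Subset n → ℕ
wsum {zero} w [] = 0
wsum {suc n} w (b ∷ S) = (if b then w zero else 0) + wsum (w ∘ suc) S

Disjoint : {n : ℕ} → Subset n → Subset n → Set
Disjoint {n} S F = ∀ (x : Fin n) → x ∈ S → x ∉ F

YesInstance : {n : ℕ} → Graph n → ℤ → Subset n → (Fin n → ℕ) → Set
YesInstance {n} G k F w = ∃ λ (S : Subset n) →
  (+ wsum w S) ≤ℤ k × Disjoint S F × Is2ClubCluster G (∁ S)

module Submission where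

-- If a solution S meets C, replace S ∩ C by v: this is no heavier, as w v ≤ w u for any
-- u ∈ S ∩ C, and avoids F ∪ C since v ∉ F. After deleting v, C is a whole
-- component of what is left, and a 2-club. Every other component lies inside a component of
-- G - S, so its distances are at most two there; the only middle vertex that may now be
-- missing is v. If x — v — y and the path from x continues with x′, then by induction along
-- the path d(x′, y) ≤ 2 without v, and the walk x x′ z y either has a chord or is an induced
-- P4 between two neighbours of v, which is excluded since v is not a bridge vertex.

open import Defs
open import Data.Nat using (ℕ; zero; suc; _+_; _≤_; z≤n; NonZero)
open import Data.Nat.Properties
  using (+-assoc; +-identityʳ; +-monoʳ-≤; m≤m+n; m≤n+m; m≤n⇒m≤o+n; ≤-trans; +-commutativeSemigroup; module ≤-Reasoning)
open import Algebra.Properties.CommutativeSemigroup +-commutativeSemigroup using (x∙yz≈y∙xz)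
open import Data.Integer using (ℤ; +≤+)
import Data.Integer.Properties as ℤ
open import Data.Bool using (true; false; if_then_else_)
open import Data.Bool.Properties using () renaming (_≟_ to _≟ᵇ_)
open import Data.Fin using (Fin; zero; suc; _≟_)
open import Data.Fin.Subset using (Subset; _∈_; _∉_; _⊆_; _∪_; _∩_; ∁; ⁅_⁆; ⊥; Empty)
open import Data.Fin.Subset.Properties
  using (x∈p∪q⁻; x∈p∪q⁺; x∈p∩q⁺; x∈p∩q⁻; x∉p⇒x∈∁p; x∈∁p⇒x∉p; x∉∁p⇒x∈p; x∈⁅x⁆; x∈⁅y⁆⇒x≡y; nonempty?; _∈?_)
open import Data.Vec using ([]; _∷_; here; there)
open import Data.Product using (_×_; _,_; proj₁; proj₂)
open import Data.Sum using (_⊎_; inj₁; inj₂; [_,_])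
open import Data.Empty using (⊥-elim)
open import Function using (_∘_; const)
open import Function.Bundles using (_⇔_; mk⇔)
open import Relation.Nullary using (¬_; yes; no)
open import Relation.Binary.Definitions using (Decidable)
open import Relation.Binary.PropositionalEquality using (_≡_; _≢_; refl; sym; trans; cong)

wsum-⊥ : ∀ {n} (w : Fin n → ℕ) → wsum w ⊥ ≡ 0
wsum-⊥ {zero}  w = refl
wsum-⊥ {suc n} w = wsum-⊥ (w ∘ suc)

wsum-⁅⁆ : ∀ {n} (w : Fin n → ℕ) (x : Fin n) → wsum w ⁅ x ⁆ ≡ w x
wsum-⁅⁆ w zero    = trans (cong (w zero +_) (wsum-⊥ (w ∘ suc))) (+-identityʳ (w zero))
wsum-⁅⁆ w (suc x) = wsum-⁅⁆ (w ∘ suc) x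

wsum-∪ : ∀ {n} (w : Fin n → ℕ) (p q : Subset n) → wsum w (p ∪ q) ≤ wsum w p + wsum w q
wsum-∪ w [] [] = z≤n
wsum-∪ w (true ∷ p) (b ∷ q) = begin
  w zero + wsum (w ∘ suc) (p ∪ q)  ≤⟨ +-monoʳ-≤ (w zero) (wsum-∪ (w ∘ suc) p q) ⟩
  w zero + (P + Q)                 ≤⟨ +-monoʳ-≤ (w zero) (+-monoʳ-≤ P (m≤n+m Q _)) ⟩
  w zero + (P + (wb + Q))          ≡⟨ sym (+-assoc (w zero) P (wb + Q)) ⟩
  (w zero + P) + (wb + Q)          ∎
  where
    open ≤-Reasoning
    P Q wb : ℕ
    P = wsum (w ∘ suc) p
    Q = wsum (w ∘ suc) q
    wb = if b then w zero else 0
wsum-∪ w (false ∷ p) (true ∷ q) = begin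
  w zero + wsum (w ∘ suc) (p ∪ q)  ≤⟨ +-monoʳ-≤ (w zero) (wsum-∪ (w ∘ suc) p q) ⟩
  w zero + (P + Q)                 ≡⟨ x∙yz≈y∙xz P (w zero) Q ⟨
  P + (w zero + Q)                 ∎
  where
    open ≤-Reasoning
    P Q : ℕ
    P = wsum (w ∘ suc) p
    Q = wsum (w ∘ suc) q
wsum-∪ w (false ∷ p) (false ∷ q) = wsum-∪ (w ∘ suc) p q

wsum-∩∁-+-∩ : ∀ {n} (w : Fin n → ℕ) (p q : Subset n) →
              wsum w (p ∩ ∁ q) + wsum w (p ∩ q) ≡ wsum w p
wsum-∩∁-+-∩ w [] [] = refl
wsum-∩∁-+-∩ w (true ∷ p) (true ∷ q) =
  trans (x∙yz≈y∙xz (wsum (w ∘ suc) (p ∩ ∁ q)) (w zero) _)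
        (cong (w zero +_) (wsum-∩∁-+-∩ (w ∘ suc) p q))
wsum-∩∁-+-∩ w (true ∷ p) (false ∷ q) =
  trans (+-assoc (w zero) _ _) (cong (w zero +_) (wsum-∩∁-+-∩ (w ∘ suc) p q))
wsum-∩∁-+-∩ w (false ∷ p) (b ∷ q) = wsum-∩∁-+-∩ (w ∘ suc) p q

wsum-∈ : ∀ {n} (w : Fin n → ℕ) {p : Subset n} {x} → x ∈ p → w x ≤ wsum w p
wsum-∈ w {true ∷ p} here = m≤m+n (w zero) _
wsum-∈ w {b ∷ p} (there x∈p) = m≤n⇒m≤o+n (if b then w zero else 0) (wsum-∈ (w ∘ suc) x∈p)

Disjoint-∪ : ∀ {n} {S F C : Subset n} → Disjoint S F → Empty (S ∩ C) → Disjoint S (F ∪ C)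
Disjoint-∪ {F = F} {C} S#F S∩C≡∅ x x∈S x∈F∪C with x∈p∪q⁻ F C x∈F∪C
... | inj₁ x∈F = S#F x x∈S x∈F
... | inj₂ x∈C = S∩C≡∅ (x , x∈p∩q⁺ (x∈S , x∈C))

exchange : ∀ {n} → Subset n → Subset n → Fin n → Subset n
exchange S C v = (S ∩ ∁ C) ∪ ⁅ v ⁆

module _ {n : ℕ} {S C : Subset n} {v : Fin n} where

  ∈exchange⁻ : ∀ {x} → x ∈ exchange S C v → (x ∈ S × x ∉ C) ⊎ x ≡ v
  ∈exchange⁻ {x} x∈S′ with x∈p∪q⁻ (S ∩ ∁ C) ⁅ v ⁆ x∈S′
  ... | inj₁ x∈S∖C = let x∈S , x∈∁C = x∈p∩q⁻ S (∁ C) x∈S∖C in inj₁ (x∈S , x∈∁p⇒x∉p x∈∁C)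
  ... | inj₂ x∈⁅v⁆ = inj₂ (x∈⁅y⁆⇒x≡y v x∈⁅v⁆)

  ∈∁exchange⁺ : ∀ {x} → (x ∈ S → x ∈ C) → x ≢ v → x ∈ ∁ (exchange S C v)
  ∈∁exchange⁺ S⇒C x≢v = x∉p⇒x∈∁p ([ (λ (x∈S , x∉C) → x∉C (S⇒C x∈S)) , x≢v ] ∘ ∈exchange⁻)

  ∈∁exchange⁻ : ∀ {x} → x ∈ ∁ (exchange S C v) → (x ∈ S → x ∈ C) × x ≢ v
  ∈∁exchange⁻ x∈T =
      (λ x∈S → x∉∁p⇒x∈p λ x∈∁C → x∉S′ (x∈p∪q⁺ (inj₁ (x∈p∩q⁺ (x∈S , x∈∁C)))))
    , (λ { refl → x∉S′ (x∈p∪q⁺ (inj₂ (x∈⁅x⁆ v))) })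
    where
      x∉S′ : _ ∉ exchange S C v
      x∉S′ = x∈∁p⇒x∉p x∈T

  exchange-disjoint : ∀ {F} → v ∉ F → v ∉ C → Disjoint S F → Disjoint (exchange S C v) (F ∪ C)
  exchange-disjoint {F} v∉F v∉C S#F x x∈S′ x∈F∪C with ∈exchange⁻ x∈S′ | x∈p∪q⁻ F C x∈F∪C
  ... | inj₁ (x∈S , _)   | inj₁ x∈F = S#F x x∈S x∈F
  ... | inj₁ (_   , x∉C) | inj₂ x∈C = x∉C x∈C
  ... | inj₂ refl        | inj₁ x∈F = v∉F x∈F
  ... | inj₂ refl        | inj₂ x∈C = v∉C x∈C

  wsum-exchange : ∀ (w : Fin n → ℕ) {u} → u ∈ S ∩ C → w v ≤ w u → wsum w (exchange S C v) ≤ wsum w S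
  wsum-exchange w {u} u∈S∩C wv≤wu = begin
    wsum w (exchange S C v)           ≤⟨ wsum-∪ w (S ∩ ∁ C) ⁅ v ⁆ ⟩
    wsum w (S ∩ ∁ C) + wsum w ⁅ v ⁆   ≡⟨ cong (wsum w (S ∩ ∁ C) +_) (wsum-⁅⁆ w v) ⟩
    wsum w (S ∩ ∁ C) + w v            ≤⟨ +-monoʳ-≤ (wsum w (S ∩ ∁ C)) (≤-trans wv≤wu (wsum-∈ w u∈S∩C)) ⟩
    wsum w (S ∩ ∁ C) + wsum w (S ∩ C) ≡⟨ wsum-∩∁-+-∩ w S C ⟩
    wsum w S                          ∎
    where open ≤-Reasoning

module _ {n : ℕ} (G : Graph n) where
  open Graph G using (adj; symm; irrefl)

  Adj? : Decidable (Adj G)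
  Adj? x y = adj x y ≟ᵇ true

  Adj-sym : ∀ {x y} → Adj G x y → Adj G y x
  Adj-sym {x} {y} xy = trans (symm y x) xy

  Adj⇒≢ : ∀ {x y} → Adj G x y → x ≢ y
  Adj⇒≢ {x} xx refl with trans (sym xx) (irrefl x)
  ... | ()

  Reach-mono : ∀ {A B} → A ⊆ B → ∀ {x y} → Reach G A x y → Reach G B x y
  Reach-mono A⊆B (here x∈A)       = here (A⊆B x∈A)
  Reach-mono A⊆B (step x∈A xy r) = step (A⊆B x∈A) xy (Reach-mono A⊆B r)

  Reach-head : ∀ {A x y} → Reach G A x y → x ∈ A
  Reach-head (here x∈A)     = x∈A
  Reach-head (step x∈A _ _) = x∈A

  Reach-last : ∀ {A x y} → Reach G A x y → y ∈ A
  Reach-last (here y∈A)   = y∈A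
  Reach-last (step _ _ r) = Reach-last r

  Dist≤2-mono : ∀ {A B} → A ⊆ B → ∀ {x y} → Dist≤2 G A x y → Dist≤2 G B x y
  Dist≤2-mono A⊆B (inj₁ x≡y)                        = inj₁ x≡y
  Dist≤2-mono A⊆B (inj₂ (inj₁ xy))                  = inj₂ (inj₁ xy)
  Dist≤2-mono A⊆B (inj₂ (inj₂ (z , z∈A , xz , zy))) = inj₂ (inj₂ (z , A⊆B z∈A , xz , zy))

  component-∋-neighbour : ∀ {S C} → IsComponent G S C →
                          ∀ {x y} → x ∈ C → Adj G x y → y ∈ S → y ∈ C
  component-∋-neighbour (_ , C⊆S , closed) x∈C xy y∈S =
    proj₂ (closed _ _ x∈C y∈S) (step (C⊆S x∈C) xy (here y∈S))

  ≢⇒∈all-but : ∀ {v x} → x ≢ v → x ∈ all-but G v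
  ≢⇒∈all-but {v} x≢v = x∉p⇒x∈∁p (x≢v ∘ x∈⁅y⁆⇒x≡y v)

  component-of-all-but-∌ : ∀ {v C} → IsComponent G (all-but G v) C → v ∉ C
  component-of-all-but-∌ {v} (_ , C⊆ , _) v∈C = x∈∁p⇒x∉p (C⊆ v∈C) (x∈⁅x⁆ v)

  walk₃-chord-or-P4 : ∀ {s t u v} → Adj G s t → Adj G t u → Adj G u v →
    s ≡ v ⊎ Adj G s v ⊎ Adj G s u ⊎ Adj G t v ⊎ InducedP4 G s t u v
  walk₃-chord-or-P4 {s} {t} {u} {v} st tu uv with s ≟ v | Adj? s v | Adj? s u | Adj? t v
  ... | yes s≡v | _      | _      | _      = inj₁ s≡v
  ... | no _    | yes sv | _      | _      = inj₂ (inj₁ sv)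
  ... | no _    | no _   | yes su | _      = inj₂ (inj₂ (inj₁ su))
  ... | no _    | no _   | no _   | yes tv = inj₂ (inj₂ (inj₂ (inj₁ tv)))
  ... | no s≢v  | no ¬sv | no ¬su | no ¬tv = inj₂ (inj₂ (inj₂ (inj₂
    ( Adj⇒≢ st , (λ { refl → ¬sv uv }) , s≢v , Adj⇒≢ tu , (λ { refl → ¬sv st }) , Adj⇒≢ uv
    , st , tu , uv , ¬su , ¬sv , ¬tv ))))

  non-bridge-shortcut : ∀ {b T x y x′} → ¬ IsBridgeVertex G b →
    Adj G x b → Adj G b y → Adj G x x′ → x′ ∈ T → Dist≤2 G T x′ y → Dist≤2 G T x y
  non-bridge-shortcut nb xb by xx′ x′∈T (inj₁ refl)        = inj₂ (inj₁ xx′)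
  non-bridge-shortcut nb xb by xx′ x′∈T (inj₂ (inj₁ x′y)) = inj₂ (inj₂ (_ , x′∈T , xx′ , x′y))
  non-bridge-shortcut {x = x} {y} {x′} nb xb by xx′ x′∈T (inj₂ (inj₂ (z , z∈T , x′z , zy)))
    with walk₃-chord-or-P4 xx′ x′z zy
  ... | inj₁ x≡y                       = inj₁ x≡y
  ... | inj₂ (inj₁ xy)                 = inj₂ (inj₁ xy)
  ... | inj₂ (inj₂ (inj₁ xz))          = inj₂ (inj₂ (z , z∈T , xz , zy))
  ... | inj₂ (inj₂ (inj₂ (inj₁ x′y)))  = inj₂ (inj₂ (x′ , x′∈T , xx′ , x′y))
  ... | inj₂ (inj₂ (inj₂ (inj₂ p4)))   = ⊥-elim (nb (x , y , Adj-sym xb , by , x′ , z , p4))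

  module _ {v : Fin n} (nb : ¬ IsBridgeVertex G v)
           {C : Subset n} (isC : IsComponent G (all-but G v) C) (club : Is2Club G C)
           {S : Subset n} (clS : Is2ClubCluster G (∁ S)) where

    private
      T : Subset n
      T = ∁ (exchange S C v)

      T⊆all-but : T ⊆ all-but G v
      T⊆all-but = ≢⇒∈all-but ∘ proj₂ ∘ ∈∁exchange⁻

      C⊆T : C ⊆ T
      C⊆T x∈C = ∈∁exchange⁺ (const x∈C) λ { refl → component-of-all-but-∌ isC x∈C }

      T∖C⊆∁S : ∀ {x} → x ∈ T → x ∉ C → x ∈ ∁ S
      T∖C⊆∁S x∈T x∉C = x∉p⇒x∈∁p (x∉C ∘ proj₁ (∈∁exchange⁻ x∈T))

      ∉C-step : ∀ {x x′} → x ∈ T → x ∉ C → Adj G x x′ → x′ ∈ T → x′ ∉ C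
      ∉C-step x∈T x∉C xx′ x′∈T x′∈C =
        x∉C (component-∋-neighbour isC x′∈C (Adj-sym xx′) (T⊆all-but x∈T))

      Reach-outside : ∀ {x y} → x ∉ C → Reach G T x y → Reach G (∁ S) x y
      Reach-outside x∉C (here x∈T)       = here (T∖C⊆∁S x∈T x∉C)
      Reach-outside x∉C (step x∈T xx′ r) =
        step (T∖C⊆∁S x∈T x∉C) xx′ (Reach-outside (∉C-step x∈T x∉C xx′ (Reach-head r)) r)

      dist-outside : ∀ {x y} → x ∉ C → Reach G T x y → Dist≤2 G T x y
      dist-outside x∉C (here _) = inj₁ refl
      dist-outside {x} {y} x∉C r@(step x∈T xx′ r′) with clS x y (Reach-outside x∉C r)
      ... | inj₁ x≡y       = inj₁ x≡y
      ... | inj₂ (inj₁ xy) = inj₂ (inj₁ xy)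
      ... | inj₂ (inj₂ (z , z∈∁S , xz , zy)) with z ≟ v
      ... | no z≢v  = inj₂ (inj₂ (z , ∈∁exchange⁺ (⊥-elim ∘ x∈∁p⇒x∉p z∈∁S) z≢v , xz , zy))
      ... | yes refl = non-bridge-shortcut nb xz zy xx′ (Reach-head r′)
                         (dist-outside (∉C-step x∈T x∉C xx′ (Reach-head r′)) r′)

      dist-inside : ∀ {x y} → x ∈ C → Reach G T x y → Dist≤2 G T x y
      dist-inside {x} {y} x∈C r = Dist≤2-mono C⊆T (club x y x∈C y∈C)
        where
          y∈C : y ∈ C
          y∈C = proj₂ (proj₂ (proj₂ isC) x y x∈C (T⊆all-but (Reach-last r))) (Reach-mono T⊆all-but r)

    exchange-2ClubCluster : Is2ClubCluster G (∁ (exchange S C v))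
    exchange-2ClubCluster x y r with x ∈? C
    ... | yes x∈C = dist-inside x∈C r
    ... | no x∉C  = dist-outside x∉C r

lemma5 : {n : ℕ} (G : Graph n) (k : ℤ) (F : Subset n) (w : Fin n → ℕ)
    → (∀ x → NonZero (w x))
    → (v : Fin n) → v ∉ F → IsCutVertex G v → ¬ IsBridgeVertex G v
    → (C : Subset n) → IsComponent G (all-but G v) C → Is2Club G C
    → (∀ u → u ∈ C → w v ≤ w u)
    → YesInstance G k F w ⇔ YesInstance G k (F ∪ C) w
lemma5 G k F w _ v v∉F _ nb C isC club wv≤ = mk⇔ forward backward
  where
    forward : YesInstance G k F w → YesInstance G k (F ∪ C) w
    forward (S , wS≤k , S#F , clS) with nonempty? (S ∩ C)
    ... | no S∩C≡∅ = S , wS≤k , Disjoint-∪ S#F S∩C≡∅ , clS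
    ... | yes (u , u∈S∩C) =
        exchange S C v
      , ℤ.≤-trans (+≤+ (wsum-exchange w u∈S∩C (wv≤ u (proj₂ (x∈p∩q⁻ S C u∈S∩C))))) wS≤k
      , exchange-disjoint v∉F (component-of-all-but-∌ G isC) S#F
      , exchange-2ClubCluster G nb isC club clS

    backward : YesInstance G k (F ∪ C) w → YesInstance G k F w
    backward (S , wS≤k , S#F∪C , clS) = S , wS≤k , (λ x x∈S x∈F → S#F∪C x x∈S (x∈p∪q⁺ (inj₁ x∈F))) , clS
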